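{- Let $f:\mathbb{Z}_+\to\mathbb{R}$ be an arithmetic function. Then $f$ is L-additive if and only if $f$ is $gh$-decomposable.
   Context: An arithmetic function $g$ is completely additive if $g(mn)=g(m)+g(n)$ for all $m,n\in\mathbb{Z}_+$. An arithmetic function $h$ is completely multiplicative if $h(1)=1$ and $h(mn)=h(m)h(n)$ for all $m,n\in\mathbb{Z}_+$. An arithmetic function $f$ is L-additive if there is a nonzero-valued completely multiplicative function $h_f$ such that $f(mn)=f(m)h_f(n)+f(n)h_f(m)$ for all $m,n\in\mathbb{Z}_+$. An arithmetic function $f$ is $gh$-decomposable if $f=gh$ (pointwise product) for some completely additive $g$ and some nonzero-valued completely multiplicative $h$. -}

module Defs where

open import Level using (Level; _⊔_)
open import Data.Nat.Base as ℕ using (ℕ; NonZero)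
open import Data.Nat.Properties using (m*n≢0)
open import Data.Product using (Σ; ∃; _×_; _,_)
open import Relation.Nullary using (¬_)
open import Algebra.Bundles using (CommutativeRing)

record ℤ⁺ : Set where
  constructor pos
  field
    val : ℕ
    .{{nz}} : NonZero val
open ℤ⁺ public

one⁺ : ℤ⁺
one⁺ = pos 1

infixl 7 _·_
_·_ : ℤ⁺ → ℤ⁺ → ℤ⁺
pos m · pos n = pos (m ℕ.* n) {{m*n≢0 m n}}

record Field (c ℓ : Level) : Set (Level.suc (c ⊔ ℓ)) where
  field
    commutativeRing : CommutativeRing c ℓ
  open CommutativeRing commutativeRing public
  field
    0≉1     : ¬ (0# ≈ 1#)
    inverse : ∀ x → ¬ (x ≈ 0#) → ∃ λ y → x * y ≈ 1#

module _ {c ℓ : Level} (F : Field c ℓ) where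
  open Field F

  CompletelyAdditive : (ℤ⁺ → Carrier) → Set ℓ
  CompletelyAdditive g = ∀ m n → g (m · n) ≈ g m + g n

  CompletelyMultiplicative : (ℤ⁺ → Carrier) → Set ℓ
  CompletelyMultiplicative h = (h one⁺ ≈ 1#) × (∀ m n → h (m · n) ≈ h m * h n)

  NonzeroValued : (ℤ⁺ → Carrier) → Set ℓ
  NonzeroValued h = ∀ n → ¬ (h n ≈ 0#)

  LAdditive : (ℤ⁺ → Carrier) → Set (c ⊔ ℓ)
  LAdditive f = Σ (ℤ⁺ → Carrier) λ h →
    NonzeroValued h × CompletelyMultiplicative h ×
    (∀ m n → f (m · n) ≈ f m * h n + f n * h m)

  GhDecomposable : (ℤ⁺ → Carrier) → Set (c ⊔ ℓ)
  GhDecomposable f = Σ (ℤ⁺ → Carrier) λ g → Σ (ℤ⁺ → Carrier) λ h →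
    CompletelyAdditive g × NonzeroValued h × CompletelyMultiplicative h ×
    (∀ n → f n ≈ g n * h n)

{-# OPTIONS --safe #-}
-- Writing f = g h with h completely multiplicative, the right-hand side of
-- the L-additivity law f(mn) = f(m) h(n) + f(n) h(m) equals (g(m) + g(n)) h(mn),
-- so the law says g(mn) h(mn) = (g(m) + g(n)) h(mn). Hence f is L-additive
-- with respect to h exactly when g is completely additive; since h(mn) is
-- invertible, every L-additive f arises this way with g = f / h.
module Submission where

open import Defs
open import Level using (Level)
open import Function.Bundles using (_⇔_; mk⇔)
open import Data.Product using (proj₁; proj₂; _,_)
open import Relation.Nullary using (¬_)
open import Algebra.Bundles using (CommutativeRing)
import Algebra.Properties.Monoid as MonoidProperties
import Relation.Binary.Reasoning.Setoid as SetoidReasoning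

module _ {c ℓ : Level} (R : CommutativeRing c ℓ) where
  open CommutativeRing R
  open SetoidReasoning setoid

  +-*-cross-distrib : ∀ a b x y → a * x * y + b * y * x ≈ (a + b) * (x * y)
  +-*-cross-distrib a b x y = sym (begin
    (a + b) * (x * y)          ≈⟨ distribʳ (x * y) a b ⟩
    a * (x * y) + b * (x * y)  ≈⟨ +-cong (sym (*-assoc a x y)) (*-congˡ (*-comm x y)) ⟩
    a * x * y + b * (y * x)    ≈⟨ +-congˡ (sym (*-assoc b y x)) ⟩
    a * x * y + b * y * x      ∎)

module _ {c ℓ : Level} (F : Field c ℓ) where
  open Field F
  open SetoidReasoning setoid
  open MonoidProperties *-monoid using (cancelʳ)

  *-cancelʳ-nonzero : ∀ {x y z} → ¬ (z ≈ 0#) → x * z ≈ y * z → x ≈ y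
  *-cancelʳ-nonzero {x} {y} {z} z≉0 xz≈yz with inverse z z≉0
  ... | z⁻¹ , z*z⁻¹≈1 = begin
    x            ≈⟨ cancelʳ z*z⁻¹≈1 x ⟨
    x * z * z⁻¹  ≈⟨ *-congʳ xz≈yz ⟩
    y * z * z⁻¹  ≈⟨ cancelʳ z*z⁻¹≈1 y ⟩
    y            ∎

  LAdditiveWith : (ℤ⁺ → Carrier) → (ℤ⁺ → Carrier) → Set ℓ
  LAdditiveWith h f = ∀ m n → f (m · n) ≈ f m * h n + f n * h m

  cross-sum-of-product : ∀ (f g : ℤ⁺ → Carrier) {h} → CompletelyMultiplicative F h →
    (∀ n → f n ≈ g n * h n) →
    ∀ m n → f m * h n + f n * h m ≈ (g m + g n) * h (m · n)
  cross-sum-of-product f g {h} (_ , h-mult) f≈gh m n = begin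
    f m * h n + f n * h m                 ≈⟨ +-cong (*-congʳ (f≈gh m)) (*-congʳ (f≈gh n)) ⟩
    g m * h m * h n + g n * h n * h m     ≈⟨ +-*-cross-distrib commutativeRing (g m) (g n) (h m) (h n) ⟩
    (g m + g n) * (h m * h n)             ≈⟨ *-congˡ (sym (h-mult m n)) ⟩
    (g m + g n) * h (m · n)               ∎

  product-LAdditiveWith : ∀ {f g h} → CompletelyAdditive F g → CompletelyMultiplicative F h →
    (∀ n → f n ≈ g n * h n) → LAdditiveWith h f
  product-LAdditiveWith {f} {g} {h} g-add h-mult f≈gh m n = begin
    f (m · n)                ≈⟨ f≈gh (m · n) ⟩
    g (m · n) * h (m · n)    ≈⟨ *-congʳ (g-add m n) ⟩
    (g m + g n) * h (m · n)  ≈⟨ cross-sum-of-product f g h-mult f≈gh m n ⟨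
    f m * h n + f n * h m    ∎

  quotient : (f h : ℤ⁺ → Carrier) → NonzeroValued F h → ℤ⁺ → Carrier
  quotient f h h≉0 n = f n * proj₁ (inverse (h n) (h≉0 n))

  quotient-factorises : ∀ f h (h≉0 : NonzeroValued F h) n → f n ≈ quotient f h h≉0 n * h n
  quotient-factorises f h h≉0 n =
    sym (cancelʳ (trans (*-comm _ (h n)) (proj₂ (inverse (h n) (h≉0 n)))) (f n))

  quotient-completelyAdditive : ∀ {f h} (h≉0 : NonzeroValued F h) → CompletelyMultiplicative F h →
    LAdditiveWith h f → CompletelyAdditive F (quotient f h h≉0)
  quotient-completelyAdditive {f} {h} h≉0 h-mult f-ladd m n = *-cancelʳ-nonzero (h≉0 (m · n)) (begin
    g (m · n) * h (m · n)    ≈⟨ quotient-factorises f h h≉0 (m · n) ⟨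
    f (m · n)                ≈⟨ f-ladd m n ⟩
    f m * h n + f n * h m    ≈⟨ cross-sum-of-product f g h-mult (quotient-factorises f h h≉0) m n ⟩
    (g m + g n) * h (m · n)  ∎)
    where
    g : ℤ⁺ → Carrier
    g = quotient f h h≉0

theorem5 : {c ℓ : Level} (F : Field c ℓ) (f : ℤ⁺ → Field.Carrier F) →
    LAdditive F f ⇔ GhDecomposable F f
theorem5 F f = mk⇔ decompose recompose
  where
  decompose : LAdditive F f → GhDecomposable F f
  decompose (h , h≉0 , h-mult , f-ladd) =
    quotient F f h h≉0 , h , quotient-completelyAdditive F h≉0 h-mult f-ladd , h≉0 , h-mult ,
    quotient-factorises F f h h≉0
  recompose : GhDecomposable F f → LAdditive F f
  recompose (g , h , g-add , h≉0 , h-mult , f≈gh) =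
    h , h≉0 , h-mult , product-LAdditiveWith F g-add h-mult f≈gh
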